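{- For a ring $R$ the following are equivalent: (a) $R$ contains an idempotent element other than $0$ and $1$; (b) $R$ is isomorphic to the direct product of two nonzero rings; (c) the polynomial $x\in R[x]$ is a product of two noninvertible polynomials of degree $1$; (d) $x\in R[x]$ is a product of two noninvertible polynomials of positive degree; (e) $x\in R[x]$ is a product of two noninvertible polynomials (equivalently, $x$ is reducible in $R[x]$).
   Context: All rings are nonzero, commutative and unital. -}

module Defs where

open import Level using (Level; _⊔_) renaming (suc to lsuc)
open import Data.Nat using (ℕ; zero; suc; _≤_; _<_)
open import Data.List using (List; []; _∷_; map)
open import Data.Product using (Σ; ∃; _×_; _,_)
open import Relation.Nullary using (¬_)
open import Algebra.Bundles using (CommutativeRing)
open import Algebra.Construct.DirectProduct using (commutativeRing)
open import Algebra.Morphism.Structures using (module RingMorphisms)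

NonZeroRing : ∀ {c ℓ} → CommutativeRing c ℓ → Set ℓ
NonZeroRing R = ¬ (1# ≈ 0#) where open CommutativeRing R

module Poly {c ℓ} (R : CommutativeRing c ℓ) where
  open CommutativeRing R

  -- Polynomials in R[x]: coefficient lists, lowest degree first.
  -- Trailing zeros are allowed; equality is coefficientwise.
  Pol : Set c
  Pol = List Carrier

  coeff : Pol → ℕ → Carrier
  coeff []       _       = 0#
  coeff (a ∷ p)  zero    = a
  coeff (a ∷ p)  (suc i) = coeff p i

  _+ₚ_ : Pol → Pol → Pol
  []      +ₚ q       = q
  (a ∷ p) +ₚ []      = a ∷ p
  (a ∷ p) +ₚ (b ∷ q) = (a + b) ∷ (p +ₚ q)

  _*ₚ_ : Pol → Pol → Pol
  []      *ₚ q = []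
  (a ∷ p) *ₚ q = map (a *_) q +ₚ (0# ∷ (p *ₚ q))

  _≈ₚ_ : Pol → Pol → Set ℓ
  p ≈ₚ q = ∀ i → coeff p i ≈ coeff q i

  oneₚ : Pol
  oneₚ = 1# ∷ []

  Xₚ : Pol
  Xₚ = 0# ∷ 1# ∷ []

  IsUnitₚ : Pol → Set (c ⊔ ℓ)
  IsUnitₚ p = ∃ λ q → (p *ₚ q) ≈ₚ oneₚ

  HasDegree : Pol → ℕ → Set ℓ
  HasDegree p d = (¬ (coeff p d ≈ 0#)) × (∀ i → d < i → coeff p i ≈ 0#)

  HasPositiveDegree : Pol → Set ℓ
  HasPositiveDegree p = ∃ λ d → 1 ≤ d × HasDegree p d

HasNontrivialIdempotent : ∀ {c ℓ} → CommutativeRing c ℓ → Set (c ⊔ ℓ)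
HasNontrivialIdempotent R =
  ∃ λ e → (e * e ≈ e) × (¬ (e ≈ 0#)) × (¬ (e ≈ 1#))
  where open CommutativeRing R

IsoToProductOfNonzero : ∀ {c ℓ} → CommutativeRing c ℓ → Set (lsuc (c ⊔ ℓ))
IsoToProductOfNonzero {c} {ℓ} R =
  Σ (CommutativeRing c ℓ) λ S → Σ (CommutativeRing c ℓ) λ T →
    NonZeroRing S × NonZeroRing T ×
    ∃ λ (f : CommutativeRing.Carrier R → CommutativeRing.Carrier (commutativeRing S T)) →
      RingMorphisms.IsRingIsomorphism (CommutativeRing.rawRing R)
        (CommutativeRing.rawRing (commutativeRing S T)) f

XProductDeg1 : ∀ {c ℓ} → CommutativeRing c ℓ → Set (c ⊔ ℓ)
XProductDeg1 R = ∃ λ f → ∃ λ g →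
  (Xₚ ≈ₚ (f *ₚ g)) × ¬ IsUnitₚ f × ¬ IsUnitₚ g × HasDegree f 1 × HasDegree g 1
  where open Poly R

XProductPosDeg : ∀ {c ℓ} → CommutativeRing c ℓ → Set (c ⊔ ℓ)
XProductPosDeg R = ∃ λ f → ∃ λ g →
  (Xₚ ≈ₚ (f *ₚ g)) × ¬ IsUnitₚ f × ¬ IsUnitₚ g × HasPositiveDegree f × HasPositiveDegree g
  where open Poly R

XProductNonunits : ∀ {c ℓ} → CommutativeRing c ℓ → Set (c ⊔ ℓ)
XProductNonunits R = ∃ λ f → ∃ λ g →
  (Xₚ ≈ₚ (f *ₚ g)) × ¬ IsUnitₚ f × ¬ IsUnitₚ g
  where open Poly R

module Submission where

-- Two elementary facts about R drive everything: a unit is not a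
-- zero divisor, and a decomposition 1 = e + e' with e e' = 0 makes e
-- idempotent.  For (a) ⇔ (b) we use the Peirce decomposition
-- R ≅ R/Ann(e) × R/Ann(1 - e), the map being x ↦ (x, x); conversely the
-- preimage of (1, 0) is a nontrivial idempotent.  For the polynomial
-- conditions we prove the cycle (a) ⇒ (c) ⇒ (d) ⇒ (e) ⇒ (a):
--   (a) ⇒ (c):  x = ((1 - e) + e x) (e + (1 - e) x);
--   (e) ⇒ (a):  writing f = a₀ + a₁ x + …, g = b₀ + b₁ x + …, the
--   coefficients of 1 and x in x = f g give a₀ b₀ = 0 and a₀ b₁ + a₁ b₀ = 1,
--   so e = a₀ b₁ is idempotent; e = 0 would force a₀ = 0 and then g divides
--   x / x = 1, and e = 1 would symmetrically make f a unit.

open import Defs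
open import Data.Nat using (zero; suc; _<_; z≤n; s≤s)
open import Data.List using ([]; _∷_; map)
open import Data.Product using (_×_; _,_; proj₁; proj₂; ∃)
open import Function.Base using (_∘_)
open import Function.Bundles using (_⇔_; mk⇔)
open import Relation.Nullary using (¬_)
open import Algebra.Bundles using (CommutativeRing)
open import Algebra.Construct.DirectProduct using (commutativeRing)
open import Algebra.Morphism.Structures using (module RingMorphisms)
import Relation.Binary.Reasoning.Setoid as SetoidReasoning
import Algebra.Solver.Ring.NaturalCoefficients.Default as NaturalSolver
import Algebra.Properties.Ring as RingProperties

module RingFacts {c ℓ} (R : CommutativeRing c ℓ) where
  open CommutativeRing R
  open SetoidReasoning setoid
  open NaturalSolver commutativeSemiring using (solve; _:=_; _:*_)
  open RingProperties ring using ([y-z]x≈yx-zx)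

  unit-cancel : ∀ {u v w} → u * v ≈ 1# → u * w ≈ 0# → w ≈ 0#
  unit-cancel {u} {v} {w} uv≈1 uw≈0 = begin
    w            ≈⟨ *-identityˡ w ⟨
    1# * w       ≈⟨ *-cong uv≈1 refl ⟨
    (u * v) * w  ≈⟨ solve 3 (λ u v w → ((u :* v) :* w) := (v :* (u :* w))) refl u v w ⟩
    v * (u * w)  ≈⟨ *-cong refl uw≈0 ⟩
    v * 0#       ≈⟨ zeroʳ v ⟩
    0#           ∎

  orthogonal⇒idempotent : ∀ {e e′} → e + e′ ≈ 1# → e * e′ ≈ 0# → e * e ≈ e
  orthogonal⇒idempotent {e} {e′} sum≈1 ee′≈0 = begin
    e * e             ≈⟨ +-identityʳ (e * e) ⟨
    e * e + 0#        ≈⟨ +-cong refl ee′≈0 ⟨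
    e * e + e * e′    ≈⟨ distribˡ e e e′ ⟨
    e * (e + e′)      ≈⟨ *-cong refl sum≈1 ⟩
    e * 1#            ≈⟨ *-identityʳ e ⟩
    e                 ∎

  idempotent-projection : ∀ {e f} a b → e * e ≈ e → e * f ≈ 0# →
                          e * (e * a + f * b) ≈ e * a
  idempotent-projection {e} {f} a b ee≈e ef≈0 = begin
    e * (e * a + f * b)        ≈⟨ distribˡ e (e * a) (f * b) ⟩
    e * (e * a) + e * (f * b)  ≈⟨ +-cong (*-assoc e e a) (*-assoc e f b) ⟨
    (e * e) * a + (e * f) * b  ≈⟨ +-cong (*-cong ee≈e refl) (*-cong ef≈0 refl) ⟩
    e * a + 0# * b             ≈⟨ +-cong refl (zeroˡ b) ⟩
    e * a + 0#                 ≈⟨ +-identityʳ (e * a) ⟩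
    e * a                      ∎

  module Complement {e : Carrier} (ee≈e : e * e ≈ e) where
    e′ : Carrier
    e′ = 1# - e

    sum≈1 : e + e′ ≈ 1#
    sum≈1 = begin
      e + (1# - e)    ≈⟨ +-assoc e 1# (- e) ⟨
      (e + 1#) - e    ≈⟨ +-cong (+-comm e 1#) refl ⟩
      (1# + e) - e    ≈⟨ +-assoc 1# e (- e) ⟩
      1# + (e - e)    ≈⟨ +-cong refl (-‿inverseʳ e) ⟩
      1# + 0#         ≈⟨ +-identityʳ 1# ⟩
      1#              ∎

    e′e≈0 : e′ * e ≈ 0#
    e′e≈0 = begin
      (1# - e) * e        ≈⟨ [y-z]x≈yx-zx e 1# e ⟩
      1# * e - e * e      ≈⟨ +-cong (*-identityˡ e) (-‿cong ee≈e) ⟩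
      e - e               ≈⟨ -‿inverseʳ e ⟩
      0#                  ∎

    ee′≈0 : e * e′ ≈ 0#
    ee′≈0 = trans (*-comm e e′) e′e≈0

    e′e′≈e′ : e′ * e′ ≈ e′
    e′e′≈e′ = orthogonal⇒idempotent (trans (+-comm e′ e) sum≈1) e′e≈0

    e′≈0⇒e≈1 : e′ ≈ 0# → e ≈ 1#
    e′≈0⇒e≈1 e′≈0 = begin
      e         ≈⟨ +-identityʳ e ⟨
      e + 0#    ≈⟨ +-cong refl e′≈0 ⟨
      e + e′    ≈⟨ sum≈1 ⟩
      1#        ∎

  -- The quotient R / Ann(e), realised on the carrier of R with the coarser
  -- equality e x ≈ e y (a congruence since Ann(e) is an ideal).  For an
  -- idempotent e this is the corner ring e R.
  module AnnihilatorQuotient (e : Carrier) where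
    _≈ₑ_ : Carrier → Carrier → Set ℓ
    x ≈ₑ y = e * x ≈ e * y

    lift : ∀ {x y} → x ≈ y → x ≈ₑ y
    lift = *-cong refl

    +-congₑ : ∀ {x y u v} → x ≈ₑ y → u ≈ₑ v → (x + u) ≈ₑ (y + v)
    +-congₑ {x} {y} {u} {v} x≈y u≈v = begin
      e * (x + u)      ≈⟨ distribˡ e x u ⟩
      e * x + e * u    ≈⟨ +-cong x≈y u≈v ⟩
      e * y + e * v    ≈⟨ distribˡ e y v ⟨
      e * (y + v)      ∎

    *-congₑ : ∀ {x y u v} → x ≈ₑ y → u ≈ₑ v → (x * u) ≈ₑ (y * v)
    *-congₑ {x} {y} {u} {v} x≈y u≈v = begin
      e * (x * u)    ≈⟨ *-assoc e x u ⟨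
      (e * x) * u    ≈⟨ *-cong x≈y refl ⟩
      (e * y) * u    ≈⟨ solve 3 (λ e y u → ((e :* y) :* u) := (y :* (e :* u))) refl e y u ⟩
      y * (e * u)    ≈⟨ *-cong refl u≈v ⟩
      y * (e * v)    ≈⟨ solve 3 (λ e y v → (y :* (e :* v)) := (e :* (y :* v))) refl e y v ⟩
      e * (y * v)    ∎

    -‿congₑ : ∀ {x y} → x ≈ₑ y → (- x) ≈ₑ (- y)
    -‿congₑ {x} {y} x≈y = begin
      e * - x      ≈⟨ -‿distribʳ-* e x ⟨
      - (e * x)    ≈⟨ -‿cong x≈y ⟩
      - (e * y)    ≈⟨ -‿distribʳ-* e y ⟩
      e * - y      ∎
      where open RingProperties ring using (-‿distribʳ-*)

    -- Every ring law of R holds for ≈ and hence for the coarser ≈ₑ.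
    quotient : CommutativeRing c ℓ
    quotient = record
      { Carrier = Carrier ; _≈_ = _≈ₑ_ ; _+_ = _+_ ; _*_ = _*_ ; -_ = -_ ; 0# = 0# ; 1# = 1#
      ; isCommutativeRing = record
        { isRing = record
          { +-isAbelianGroup = record
            { isGroup = record
              { isMonoid = record
                { isSemigroup = record
                  { isMagma = record
                    { isEquivalence = record { refl = refl ; sym = sym ; trans = trans }
                    ; ∙-cong = +-congₑ }
                  ; assoc = λ x y z → lift (+-assoc x y z) }
                ; identity = (λ x → lift (+-identityˡ x)) , (λ x → lift (+-identityʳ x)) }
              ; inverse = (λ x → lift (-‿inverseˡ x)) , (λ x → lift (-‿inverseʳ x))
              ; ⁻¹-cong = -‿congₑ }
            ; comm = λ x y → lift (+-comm x y) }
          ; *-cong = *-congₑ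
          ; *-assoc = λ x y z → lift (*-assoc x y z)
          ; *-identity = (λ x → lift (*-identityˡ x)) , (λ x → lift (*-identityʳ x))
          ; distrib = (λ x y z → lift (distribˡ x y z)) , (λ x y z → lift (distribʳ x y z)) }
        ; *-comm = λ x y → lift (*-comm x y) } }

    quotient-nonzero : ¬ (e ≈ 0#) → NonZeroRing quotient
    quotient-nonzero e≉0 e1≈e0 = e≉0 (begin
      e        ≈⟨ *-identityʳ e ⟨
      e * 1#   ≈⟨ e1≈e0 ⟩
      e * 0#   ≈⟨ zeroʳ e ⟩
      0#       ∎)

module PolynomialArithmetic {c ℓ} (R : CommutativeRing c ℓ) where
  open CommutativeRing R
  open Poly R
  open SetoidReasoning setoid
  open NaturalSolver commutativeSemiring using (solve; _:=_; _:+_)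

  tailₚ : Pol → Pol
  tailₚ []      = []
  tailₚ (a ∷ p) = p

  coeff-+ₚ : ∀ p q i → coeff (p +ₚ q) i ≈ coeff p i + coeff q i
  coeff-+ₚ []      q       i       = sym (+-identityˡ _)
  coeff-+ₚ (a ∷ p) []      i       = sym (+-identityʳ _)
  coeff-+ₚ (a ∷ p) (b ∷ q) zero    = refl
  coeff-+ₚ (a ∷ p) (b ∷ q) (suc i) = coeff-+ₚ p q i

  coeff-scale : ∀ a q i → coeff (map (a *_) q) i ≈ a * coeff q i
  coeff-scale a []      i       = sym (zeroʳ a)
  coeff-scale a (b ∷ q) zero    = refl
  coeff-scale a (b ∷ q) (suc i) = coeff-scale a q i

  coeff-cons-*ₚ : ∀ a p q i → coeff ((a ∷ p) *ₚ q) i ≈ a * coeff q i + coeff (0# ∷ (p *ₚ q)) i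
  coeff-cons-*ₚ a p q i = trans (coeff-+ₚ (map (a *_) q) _ i) (+-cong (coeff-scale a q i) refl)

  coeff-*ₚ-cons : ∀ b q p i → coeff (p *ₚ (b ∷ q)) i ≈ b * coeff p i + coeff (0# ∷ (p *ₚ q)) i
  coeff-*ₚ-cons b q []      zero    = sym (trans (+-cong (zeroʳ b) refl) (+-identityʳ 0#))
  coeff-*ₚ-cons b q []      (suc i) = sym (trans (+-cong (zeroʳ b) refl) (+-identityʳ 0#))
  coeff-*ₚ-cons b q (a ∷ p) zero    = trans (coeff-cons-*ₚ a p (b ∷ q) 0) (+-cong (*-comm a b) refl)
  coeff-*ₚ-cons b q (a ∷ p) (suc i) = begin
    coeff ((a ∷ p) *ₚ (b ∷ q)) (suc i)                        ≈⟨ coeff-cons-*ₚ a p (b ∷ q) (suc i) ⟩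
    a * coeff q i + coeff (p *ₚ (b ∷ q)) i                    ≈⟨ +-cong refl (coeff-*ₚ-cons b q p i) ⟩
    a * coeff q i + (b * coeff p i + coeff (0# ∷ (p *ₚ q)) i) ≈⟨ swap-summands _ _ _ ⟩
    b * coeff p i + (a * coeff q i + coeff (0# ∷ (p *ₚ q)) i) ≈⟨ +-cong refl (coeff-cons-*ₚ a p q i) ⟨
    b * coeff p i + coeff ((a ∷ p) *ₚ q) i                    ∎
    where
    swap-summands : ∀ x y z → x + (y + z) ≈ y + (x + z)
    swap-summands = solve 3 (λ x y z → (x :+ (y :+ z)) := (y :+ (x :+ z))) refl

  coeff-*ₚ-[] : ∀ p i → coeff (p *ₚ []) i ≈ 0#
  coeff-*ₚ-[] []      i       = refl
  coeff-*ₚ-[] (a ∷ p) zero    = refl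
  coeff-*ₚ-[] (a ∷ p) (suc i) = coeff-*ₚ-[] p i

  *ₚ-comm : ∀ p q → (p *ₚ q) ≈ₚ (q *ₚ p)
  *ₚ-comm []      q i = sym (coeff-*ₚ-[] q i)
  *ₚ-comm (a ∷ p) q i =
    trans (coeff-cons-*ₚ a p q i) (trans (+-cong refl (shifted i)) (sym (coeff-*ₚ-cons a p q i)))
    where
    shifted : ∀ i → coeff (0# ∷ (p *ₚ q)) i ≈ coeff (0# ∷ (q *ₚ p)) i
    shifted zero    = refl
    shifted (suc i) = *ₚ-comm p q i

  coeff-*ₚ-zero : ∀ p q → coeff (p *ₚ q) 0 ≈ coeff p 0 * coeff q 0
  coeff-*ₚ-zero []      q = sym (zeroˡ _)
  coeff-*ₚ-zero (a ∷ p) q = trans (coeff-cons-*ₚ a p q 0) (+-identityʳ _)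

  coeff-*ₚ-suc : ∀ p q i →
                 coeff (p *ₚ q) (suc i) ≈ coeff p 0 * coeff q (suc i) + coeff (tailₚ p *ₚ q) i
  coeff-*ₚ-suc []      q i = sym (trans (+-cong (zeroˡ _) refl) (+-identityʳ 0#))
  coeff-*ₚ-suc (a ∷ p) q i = coeff-cons-*ₚ a p q (suc i)

  coeff-*ₚ-one : ∀ p q →
                 coeff (p *ₚ q) 1 ≈ coeff p 0 * coeff q 1 + coeff (tailₚ p) 0 * coeff q 0
  coeff-*ₚ-one p q = trans (coeff-*ₚ-suc p q 0) (+-cong refl (coeff-*ₚ-zero (tailₚ p) q))

  unit-constant : ∀ p → IsUnitₚ p → ∃ λ a → coeff p 0 * a ≈ 1#
  unit-constant p (q , pq≈1) = coeff q 0 , trans (sym (coeff-*ₚ-zero p q)) (pq≈1 0)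

  -- If x = p q and p has no constant term, then p / x = tailₚ p is an inverse
  -- of q: comparing coefficients of x^(i+1) gives (tailₚ p) q = 1.
  x-cofactor-unit : ∀ p q → Xₚ ≈ₚ (p *ₚ q) → coeff p 0 ≈ 0# → IsUnitₚ q
  x-cofactor-unit p q x≈pq p₀≈0 = tailₚ p , λ i → trans (*ₚ-comm q (tailₚ p) i) (tail-inverse i)
    where
    tail-inverse : (tailₚ p *ₚ q) ≈ₚ oneₚ
    tail-inverse i = begin
      coeff (tailₚ p *ₚ q) i                                ≈⟨ +-identityˡ _ ⟨
      0# + coeff (tailₚ p *ₚ q) i                           ≈⟨ +-cong (trans (*-cong p₀≈0 refl) (zeroˡ _)) refl ⟨
      coeff p 0 * coeff q (suc i) + coeff (tailₚ p *ₚ q) i  ≈⟨ coeff-*ₚ-suc p q i ⟨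
      coeff (p *ₚ q) (suc i)                                ≈⟨ x≈pq (suc i) ⟨
      coeff Xₚ (suc i)                                      ∎

  linear-degree : ∀ {a b} → ¬ (b ≈ 0#) → HasDegree (a ∷ b ∷ []) 1
  linear-degree b≉0 = b≉0 , above-one
    where
    above-one : ∀ {a b} i → 1 < i → coeff (a ∷ b ∷ []) i ≈ 0#
    above-one (suc (suc i)) _           = refl
    above-one (suc zero)    (s≤s ())

module Implications {c ℓ} (R : CommutativeRing c ℓ) where
  open CommutativeRing R
  open Poly R
  open RingFacts R
  open PolynomialArithmetic R

  a⇒b : HasNontrivialIdempotent R → IsoToProductOfNonzero R
  a⇒b (e , ee≈e , e≉0 , e≉1) =
    S.quotient , T.quotient , S.quotient-nonzero e≉0 , T.quotient-nonzero (e≉1 ∘ e′≈0⇒e≈1) ,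
    (λ x → x , x) , peirce
    where
    open Complement ee≈e
    module S = AnnihilatorQuotient e
    module T = AnnihilatorQuotient e′
    open SetoidReasoning setoid

    injective : ∀ {x y} → (e * x ≈ e * y) × (e′ * x ≈ e′ * y) → x ≈ y
    injective {x} {y} (ex≈ey , e′x≈e′y) = begin
      x               ≈⟨ *-identityˡ x ⟨
      1# * x          ≈⟨ *-cong sum≈1 refl ⟨
      (e + e′) * x    ≈⟨ distribʳ x e e′ ⟩
      e * x + e′ * x  ≈⟨ +-cong ex≈ey e′x≈e′y ⟩
      e * y + e′ * y  ≈⟨ distribʳ y e e′ ⟨
      (e + e′) * y    ≈⟨ *-cong sum≈1 refl ⟩
      1# * y          ≈⟨ *-identityˡ y ⟩
      y               ∎

    surjective : ∀ (ab : Carrier × Carrier) → ∃ λ x → ∀ {z} → z ≈ x →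
                 (e * z ≈ e * proj₁ ab) × (e′ * z ≈ e′ * proj₂ ab)
    surjective (a , b) = e * a + e′ * b , λ {z} z≈x →
      trans (*-cong refl z≈x) (idempotent-projection a b ee≈e ee′≈0) ,
      trans (*-cong refl (trans z≈x (+-comm (e * a) (e′ * b))))
            (idempotent-projection b a e′e′≈e′ e′e≈0)

    peirce : RingMorphisms.IsRingIsomorphism rawRing
               (CommutativeRing.rawRing (commutativeRing S.quotient T.quotient)) (λ x → x , x)
    peirce = record
      { isRingMonomorphism = record
        { isRingHomomorphism = record
          { isSemiringHomomorphism = record
            { isNearSemiringHomomorphism = record
              { +-isMonoidHomomorphism = record
                { isMagmaHomomorphism = record
                  { isRelHomomorphism = record { cong = λ x≈y → S.lift x≈y , T.lift x≈y }
                  ; homo = λ x y → refl , refl }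
                ; ε-homo = refl , refl }
              ; *-homo = λ x y → refl , refl }
            ; 1#-homo = refl , refl }
          ; -‿homo = λ x → refl , refl }
        ; injective = injective }
      ; surjective = surjective }

  b⇒a : IsoToProductOfNonzero R → HasNontrivialIdempotent R
  b⇒a (S , T , S-nonzero , T-nonzero , φ , iso) = e , ee≈e , e≉0 , e≉1
    where
    module S = CommutativeRing S
    module T = CommutativeRing T
    open RingMorphisms.IsRingIsomorphism iso

    e : Carrier
    e = proj₁ (surjective (S.1# , T.0#))

    φe≈10 : (proj₁ (φ e) S.≈ S.1#) × (proj₂ (φ e) T.≈ T.0#)
    φe≈10 = proj₂ (surjective (S.1# , T.0#)) refl

    ee≈e : e * e ≈ e
    ee≈e = injective
      ( S.trans (proj₁ (*-homo e e))
          (S.trans (S.*-cong (proj₁ φe≈10) (proj₁ φe≈10))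
            (S.trans (S.*-identityʳ S.1#) (S.sym (proj₁ φe≈10))))
      , T.trans (proj₂ (*-homo e e))
          (T.trans (T.*-cong (proj₂ φe≈10) (proj₂ φe≈10))
            (T.trans (T.zeroʳ T.0#) (T.sym (proj₂ φe≈10)))))

    e≉0 : ¬ (e ≈ 0#)
    e≉0 e≈0 = S-nonzero
      (S.trans (S.sym (proj₁ φe≈10)) (S.trans (proj₁ (⟦⟧-cong e≈0)) (proj₁ 0#-homo)))

    e≉1 : ¬ (e ≈ 1#)
    e≉1 e≈1 = T-nonzero
      (T.sym (T.trans (T.sym (proj₂ φe≈10)) (T.trans (proj₂ (⟦⟧-cong e≈1)) (proj₂ 1#-homo))))

  -- (a) ⇒ (c): x = (e′ + e x)(e + e′ x) with e′ = 1 - e, since e e′ = 0 and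
  -- e e + e′ e′ = e + e′ = 1.  The factors have constant terms e′ and e,
  -- which are zero divisors, hence the factors are not units.
  a⇒c : HasNontrivialIdempotent R → XProductDeg1 R
  a⇒c (e , ee≈e , e≉0 , e≉1) =
    f , g , x≈fg , f-nonunit , g-nonunit , linear-degree e≉0 , linear-degree e′≉0
    where
    open Complement ee≈e

    e′≉0 : ¬ (e′ ≈ 0#)
    e′≉0 = e≉1 ∘ e′≈0⇒e≈1

    f g : Pol
    f = e′ ∷ e ∷ []
    g = e ∷ e′ ∷ []

    -- The coefficients of f g are, by computation, e′e + 0, e′e′ + (ee + 0), ee′.
    x≈fg : Xₚ ≈ₚ (f *ₚ g)
    x≈fg zero                = sym (trans (+-identityʳ _) e′e≈0)
    x≈fg (suc zero)          =
      sym (trans (+-cong e′e′≈e′ (trans (+-identityʳ _) ee≈e)) (trans (+-comm e′ e) sum≈1))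
    x≈fg (suc (suc zero))    = sym ee′≈0
    x≈fg (suc (suc (suc i))) = refl

    f-nonunit : ¬ IsUnitₚ f
    f-nonunit f-unit = e≉0 (unit-cancel (proj₂ (unit-constant f f-unit)) e′e≈0)

    g-nonunit : ¬ IsUnitₚ g
    g-nonunit g-unit = e′≉0 (unit-cancel (proj₂ (unit-constant g g-unit)) ee′≈0)

  c⇒d : XProductDeg1 R → XProductPosDeg R
  c⇒d (f , g , x≈fg , f-nonunit , g-nonunit , f-linear , g-linear) =
    f , g , x≈fg , f-nonunit , g-nonunit , (1 , s≤s z≤n , f-linear) , (1 , s≤s z≤n , g-linear)

  d⇒e : XProductPosDeg R → XProductNonunits R
  d⇒e (f , g , x≈fg , f-nonunit , g-nonunit , _ , _) = f , g , x≈fg , f-nonunit , g-nonunit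

  -- (e) ⇒ (a): from x = f g read off a₀ b₀ = 0 and a₀ b₁ + a₁ b₀ = 1; the
  -- summands are orthogonal, so e = a₀ b₁ is idempotent, and e ∈ {0, 1}
  -- would make one of the factors a unit.
  e⇒a : XProductNonunits R → HasNontrivialIdempotent R
  e⇒a (f , g , x≈fg , f-nonunit , g-nonunit) =
    e , orthogonal⇒idempotent sum≈1 ee′≈0 , e≉0 , e≉1
    where
    open SetoidReasoning setoid
    open NaturalSolver commutativeSemiring using (solve; _:=_; _:*_)

    a₀ a₁ b₀ b₁ e e′ : Carrier
    a₀ = coeff f 0
    a₁ = coeff (tailₚ f) 0
    b₀ = coeff g 0
    b₁ = coeff g 1
    e  = a₀ * b₁
    e′ = a₁ * b₀

    a₀b₀≈0 : a₀ * b₀ ≈ 0#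
    a₀b₀≈0 = sym (trans (x≈fg 0) (coeff-*ₚ-zero f g))

    sum≈1 : e + e′ ≈ 1#
    sum≈1 = sym (trans (x≈fg 1) (coeff-*ₚ-one f g))

    ee′≈0 : e * e′ ≈ 0#
    ee′≈0 = begin
      (a₀ * b₁) * (a₁ * b₀)  ≈⟨ solve 4 (λ a b c d → ((a :* b) :* (c :* d)) := ((a :* d) :* (b :* c)))
                                        refl a₀ b₁ a₁ b₀ ⟩
      (a₀ * b₀) * (b₁ * a₁)  ≈⟨ *-cong a₀b₀≈0 refl ⟩
      0# * (b₁ * a₁)         ≈⟨ zeroˡ _ ⟩
      0#                     ∎

    -- e = 0 makes b₀ a unit, so a₀ = 0 and g divides x with cofactor f.
    e≉0 : ¬ (e ≈ 0#)
    e≉0 e≈0 = g-nonunit (x-cofactor-unit f g x≈fg a₀≈0)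
      where
      b₀a₁≈1 : b₀ * a₁ ≈ 1#
      b₀a₁≈1 = trans (*-comm b₀ a₁)
                     (trans (sym (+-identityˡ e′)) (trans (+-cong (sym e≈0) refl) sum≈1))
      a₀≈0 : a₀ ≈ 0#
      a₀≈0 = unit-cancel b₀a₁≈1 (trans (*-comm b₀ a₀) a₀b₀≈0)

    -- e = 1 makes a₀ a unit, so b₀ = 0 and f divides x with cofactor g.
    e≉1 : ¬ (e ≈ 1#)
    e≉1 e≈1 = f-nonunit (x-cofactor-unit g f x≈gf (unit-cancel e≈1 a₀b₀≈0))
      where
      x≈gf : Xₚ ≈ₚ (g *ₚ f)
      x≈gf i = trans (x≈fg i) (*ₚ-comm f g i)

-- The five conditions are equivalent; (b) is compared with (a) directly and
-- (c), (d), (e) through the cycle (a) ⇒ (c) ⇒ (d) ⇒ (e) ⇒ (a).  None of the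
-- implications needs R to be nonzero.
proposition6p4 : ∀ {c ℓ} (R : CommutativeRing c ℓ) → NonZeroRing R →
    (HasNontrivialIdempotent R ⇔ IsoToProductOfNonzero R) ×
    (HasNontrivialIdempotent R ⇔ XProductDeg1 R) ×
    (HasNontrivialIdempotent R ⇔ XProductPosDeg R) ×
    (HasNontrivialIdempotent R ⇔ XProductNonunits R)
proposition6p4 R _ =
  mk⇔ a⇒b b⇒a ,
  mk⇔ a⇒c (e⇒a ∘ d⇒e ∘ c⇒d) ,
  mk⇔ (c⇒d ∘ a⇒c) (e⇒a ∘ d⇒e) ,
  mk⇔ (d⇒e ∘ c⇒d ∘ a⇒c) e⇒a
  where open Implications R
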